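{- Let $X$ and $Y$ be nonempty finite subsets of Euclidean space. Then: (i) $\operatorname{orth}(\phi+\psi)\geq\min\{\operatorname{orth}\phi,\operatorname{orth}\psi\}$ for all $\phi,\psi\colon X\to\mathbb{R}$; (ii) $\operatorname{orth}(\phi\otimes\psi)=\operatorname{orth}(\phi)+\operatorname{orth}(\psi)$ for all $\phi\colon X\to\mathbb{R}$ and $\psi\colon Y\to\mathbb{R}$; (iii) $\operatorname{orth}(\phi^{\otimes n}-\psi^{\otimes n})\geq\operatorname{orth}(\phi-\psi)$ for all $\phi,\psi\colon X\to\mathbb{R}$ and all integers $n\geq1$.
   Context: For a real function $\phi$ on a finite subset $X\subset\mathbb{R}^m$, $\operatorname{orth}\phi$ (orthogonal content) is the minimum total degree of a real polynomial $p$ on $\mathbb{R}^m$ with $\sum_{x\in X}\phi(x)p(x)\neq0$, and $\operatorname{orth}\phi=\infty$ if no such polynomial exists (i.e., $\phi\equiv0$); $\infty+a=\infty$. The tensor product is $(\phi\otimes\psi)(x,y)=\phi(x)\psi(y)$ on $X\times Y$, and $\phi^{\otimes n}$ is the $n$-fold tensor product of $\phi$ with itself. -}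

module Defs where

open import Level using (Level)
open import Algebra.Bundles using (CommutativeRing)
open import Data.Nat as ℕ using (ℕ; zero; suc)
open import Data.Fin using (Fin; zero; suc; remQuot)
open import Data.Product using (_×_; _,_; Σ; ∃; proj₁; proj₂)
open import Data.List using (List; []; _∷_)
open import Data.Vec.Functional using (Vector; _++_) renaming ([] to []ᵛ)
open import Relation.Binary.PropositionalEquality using (_≡_)
open import Relation.Nullary using (¬_)

data ℕ∞ : Set where
  fin : ℕ → ℕ∞
  ∞   : ℕ∞

infix 4 _≤∞_
data _≤∞_ : ℕ∞ → ℕ∞ → Set where
  fin≤fin : ∀ {a b} → a ℕ.≤ b → fin a ≤∞ fin b
  _≤∞∞    : ∀ a → a ≤∞ ∞

min∞ : ℕ∞ → ℕ∞ → ℕ∞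
min∞ (fin a) (fin b) = fin (a ℕ.⊓ b)
min∞ (fin a) ∞       = fin a
min∞ ∞       b       = b

infixl 6 _+∞_
_+∞_ : ℕ∞ → ℕ∞ → ℕ∞
fin a +∞ fin b = fin (a ℕ.+ b)
fin a +∞ ∞     = ∞
∞     +∞ b     = ∞

-- Everything below is over a field F (standing in for ℝ).

record IsField {c ℓ : Level} (F : CommutativeRing c ℓ) : Set (Level._⊔_ c ℓ) where
  open CommutativeRing F
  field
    1≉0     : ¬ (1# ≈ 0#)
    inverse : ∀ x → ¬ (x ≈ 0#) → ∃ λ y → x * y ≈ 1#

module Over {c ℓ : Level} (F : CommutativeRing c ℓ) where
  open CommutativeRing F using (Carrier; _≈_; _+_; _*_; _-_; 0#; 1#)

  Point : ℕ → Set c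
  Point m = Vector Carrier m

  SamePoint : ∀ {m} → Point m → Point m → Set ℓ
  SamePoint {m} x y = (j : Fin m) → x j ≈ y j

  record FinSubset (m : ℕ) : Set c where
    field
      size : ℕ
      pt   : Fin size → Point m
  open FinSubset public

  Distinct : ∀ {m} → FinSubset m → Set ℓ
  Distinct X = ∀ i j → SamePoint (pt X i) (pt X j) → i ≡ j

  Nonempty : ∀ {m} → FinSubset m → Set
  Nonempty X = 0 ℕ.< size X

  Fun : ∀ {m} → FinSubset m → Set c
  Fun X = Fin (size X) → Carrier

  _⊕_ : ∀ {m} {X : FinSubset m} → Fun X → Fun X → Fun X
  (φ ⊕ ψ) i = φ i + ψ i

  _⊖_ : ∀ {m} {X : FinSubset m} → Fun X → Fun X → Fun X
  (φ ⊖ ψ) i = φ i - ψ i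

  Σ[_] : ∀ {n} → (Fin n → Carrier) → Carrier
  Σ[_] {zero}  f = 0#
  Σ[_] {suc n} f = f zero + Σ[ (λ i → f (suc i)) ]

  Π[_] : ∀ {n} → (Fin n → Carrier) → Carrier
  Π[_] {zero}  f = 1#
  Π[_] {suc n} f = f zero * Π[ (λ i → f (suc i)) ]

  pow : Carrier → ℕ → Carrier
  pow x zero    = 1#
  pow x (suc k) = x * pow x k

  sumℕ : ∀ {n} → (Fin n → ℕ) → ℕ
  sumℕ {zero}  f = 0
  sumℕ {suc n} f = f zero ℕ.+ sumℕ (λ i → f (suc i))

  Poly : ℕ → Set c
  Poly m = List (Carrier × (Fin m → ℕ))

  monomial : ∀ {m} → (Fin m → ℕ) → Point m → Carrier
  monomial e x = Π[ (λ j → pow (x j) (e j)) ]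

  eval : ∀ {m} → Poly m → Point m → Carrier
  eval []            x = 0#
  eval ((a , e) ∷ p) x = a * monomial e x + eval p x

  -- total degree of the (formal) representation: largest total degree of a
  -- listed monomial
  deg : ∀ {m} → Poly m → ℕ
  deg []            = 0
  deg ((a , e) ∷ p) = sumℕ e ℕ.⊔ deg p

  pairing : ∀ {m} (X : FinSubset m) → Fun X → Poly m → Carrier
  pairing X φ p = Σ[ (λ i → φ i * eval p (pt X i)) ]

  -- Orth X φ k  :⇔  orth φ = k.
  --   orth φ = d  iff  some polynomial of degree d has nonzero pairing with φ
  --                    and every polynomial of degree < d has zero pairing;
  --   orth φ = ∞  iff  no polynomial has nonzero pairing with φ.
  Orth : ∀ {m} (X : FinSubset m) → Fun X → ℕ∞ → Set (Level._⊔_ c ℓ)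
  Orth X φ (fin d) =
    (Σ (Poly _) λ p → deg p ≡ d × ¬ (pairing X φ p ≈ 0#))
    × (∀ (p : Poly _) → deg p ℕ.< d → pairing X φ p ≈ 0#)
  Orth X φ ∞ = ∀ (p : Poly _) → pairing X φ p ≈ 0#

  _×ˢ_ : ∀ {m m'} → FinSubset m → FinSubset m' → FinSubset (m ℕ.+ m')
  X ×ˢ Y = record
    { size = size X ℕ.* size Y
    ; pt   = λ k → pt X (proj₁ (remQuot {size X} (size Y) k))
                   ++ pt Y (proj₂ (remQuot {size X} (size Y) k))
    }

  _⊗_ : ∀ {m m'} {X : FinSubset m} {Y : FinSubset m'} →
        Fun X → Fun Y → Fun (X ×ˢ Y)
  _⊗_ {X = X} {Y = Y} φ ψ k = φ (proj₁ (remQuot {size X} (size Y) k)) * ψ (proj₂ (remQuot {size X} (size Y) k))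

  powDim : ℕ → ℕ → ℕ
  powDim m zero    = 0
  powDim m (suc n) = powDim m n ℕ.+ m

  _^ˢ_ : ∀ {m} → FinSubset m → (n : ℕ) → FinSubset (powDim m n)
  X ^ˢ zero  = record { size = 1 ; pt = λ _ → []ᵛ }
  X ^ˢ suc n = (X ^ˢ n) ×ˢ X

  _^⊗_ : ∀ {m} {X : FinSubset m} → Fun X → (n : ℕ) → Fun (X ^ˢ n)
  (φ ^⊗ zero)  _ = 1#
  _^⊗_ {X = X} φ (suc n) = _⊗_ {X = X ^ˢ n} {Y = X} (φ ^⊗ n) φ

-- Everything is read off the moments ∑ₓ φ(x) xᵉ of φ: orth φ ≥ a exactly when
-- all moments of total degree below a vanish.  Moments are additive in φ, which
-- gives (i), and multiplicative under tensor products, which gives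
-- orth (φ ⊗ ψ) ≥ orth φ + orth ψ.  Conversely, if p and q witness orth φ and
-- orth ψ, then p(x) q(y) has degree at most deg p + deg q and pairs with φ ⊗ ψ
-- to ⟨φ, p⟩ ⟨ψ, q⟩ ≠ 0, as F has no zero divisors.  For (iii),
-- φ^⊗(n+1) − ψ^⊗(n+1) = (φ^⊗n − ψ^⊗n) ⊗ φ + ψ^⊗n ⊗ (φ − ψ), and by induction the
-- moments of both summands vanish below orth (φ − ψ).

module Submission where

open import Defs
open import Level using (Level)
open import Algebra.Bundles using (CommutativeRing)
open import Data.Nat using (ℕ; _≤_)
open import Data.Product using (_×_)
open import Relation.Binary.PropositionalEquality using (_≡_)

open import Algebra.Bundles using (Monoid)
open import Data.Empty using (⊥-elim)
open import Data.Fin using (Fin; zero; suc; _↑ˡ_; _↑ʳ_; combine; remQuot)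
open import Data.Fin.Properties using (remQuot-combine)
open import Data.List using ([]; _∷_; map; concatMap) renaming (_++_ to _++ᴸ_)
open import Data.Nat using (zero; suc)
import Data.Nat as ℕ
import Data.Nat.Properties as ℕₚ
open import Data.Product using (_,_; proj₁; proj₂)
open import Data.Sum using (_⊎_; inj₁; inj₂)
open import Data.Unit using (⊤; tt)
open import Data.Vec.Functional using (Vector; _++_)
open import Data.Vec.Functional.Properties using (lookup-++ˡ; lookup-++ʳ)
open import Function using (_∘_)
import Relation.Binary.PropositionalEquality as ≡
open import Relation.Nullary using (¬_; yes; no)
import Relation.Binary.Reasoning.Setoid as SetoidReasoning

infix 4 _<∞_
_<∞_ : ℕ → ℕ∞ → Set
d <∞ fin a = d ℕ.< a
d <∞ ∞     = ⊤

≤-<∞-trans : ∀ a {x y} → x ≤ y → y <∞ a → x <∞ a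
≤-<∞-trans (fin a) x≤y y<a = ℕₚ.≤-<-trans x≤y y<a
≤-<∞-trans ∞       _   _   = tt

<∞-min⁻ : ∀ a b {d} → d <∞ min∞ a b → d <∞ a × d <∞ b
<∞-min⁻ (fin a) (fin b) d<a⊓b = ℕₚ.<-≤-trans d<a⊓b (ℕₚ.m⊓n≤m a b) , ℕₚ.<-≤-trans d<a⊓b (ℕₚ.m⊓n≤n a b)
<∞-min⁻ (fin a) ∞       d<a   = d<a , tt
<∞-min⁻ ∞       b       d<b   = tt , d<b

+-<∞-+⁻ : ∀ a b {s t} → s ℕ.+ t <∞ a +∞ b → s <∞ a ⊎ t <∞ b
+-<∞-+⁻ (fin a) (fin b) {s} {t} s+t<a+b with s ℕ.<? a
... | yes s<a = inj₁ s<a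
... | no  s≮a = inj₂ (ℕₚ.+-cancelˡ-< a t b (ℕₚ.≤-<-trans (ℕₚ.+-monoˡ-≤ t (ℕₚ.≮⇒≥ s≮a)) s+t<a+b))
+-<∞-+⁻ (fin a) ∞       _       = inj₂ tt
+-<∞-+⁻ ∞       b       _       = inj₁ tt

≮∞⇒≥∞ : ∀ a {d} → ¬ (d <∞ a) → a ≤∞ fin d
≮∞⇒≥∞ (fin a) d≮a = fin≤fin (ℕₚ.≮⇒≥ d≮a)
≮∞⇒≥∞ ∞       d≮∞ = ⊥-elim (d≮∞ tt)

≤∞-antisym : ∀ {a b} → a ≤∞ b → b ≤∞ a → a ≡ b
≤∞-antisym (fin≤fin a≤b) (fin≤fin b≤a) = ≡.cong fin (ℕₚ.≤-antisym a≤b b≤a)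
≤∞-antisym (_ ≤∞∞)       (_ ≤∞∞)       = ≡.refl

min∞-idem : ∀ a → min∞ a a ≡ a
min∞-idem (fin a) = ≡.cong fin (ℕₚ.⊓-idem a)
min∞-idem ∞       = ≡.refl

module _ {a ℓ} (M : Monoid a ℓ) where
  open Monoid M
  open import Algebra.Properties.Monoid.Sum M using (sum; sum-cong-≗)

  sum-↑ : ∀ m {n} (f : Vector Carrier (m ℕ.+ n)) →
          sum f ≈ sum (f ∘ (_↑ˡ n)) ∙ sum (f ∘ (m ↑ʳ_))
  sum-↑ zero    f = sym (identityˡ _)
  sum-↑ (suc m) f = trans (∙-congˡ (sum-↑ m (f ∘ suc))) (sym (assoc _ _ _))

  sum-++ : ∀ {m n} (f : Vector Carrier m) (g : Vector Carrier n) →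
           sum (f ++ g) ≈ sum f ∙ sum g
  sum-++ {m} f g = trans (sum-↑ m (f ++ g))
    (∙-cong (reflexive (sum-cong-≗ (lookup-++ˡ f g))) (reflexive (sum-cong-≗ (lookup-++ʳ f g))))

  sum-combine : ∀ m n (f : Vector Carrier (m ℕ.* n)) →
                sum f ≈ sum {m} (λ i → sum {n} (λ j → f (combine i j)))
  sum-combine zero    n f = refl
  sum-combine (suc m) n f = trans (sum-↑ n f) (∙-congˡ (sum-combine m n (f ∘ (n ↑ʳ_))))

module OrthogonalContent {c ℓ} (F : CommutativeRing c ℓ) where
  open CommutativeRing F hiding (zero)
  open Over F
  open import Algebra.Properties.Semiring.Sum semiring
    using (sum; sum-syntax; sum-cong-≋; sum-cong-≗; sum-replicate-zero; ∑-distrib-+; *-distribˡ-sum; *-distribʳ-sum)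
  open import Algebra.Properties.Monoid.Sum *-monoid
    using () renaming (sum to product; sum-cong-≗ to product-cong-≗)
  open import Algebra.Properties.Monoid.Sum ℕₚ.+-0-monoid
    using () renaming (sum to sumᴺ)
  open import Algebra.Properties.CommutativeSemigroup *-commutativeSemigroup
    using (interchange; xy∙z≈y∙xz; x∙yz≈y∙xz)
  open import Algebra.Properties.Ring ring using ([y-z]x≈yx-zx; x[y-z]≈xy-xz)
  private module ≈-Reasoning = SetoidReasoning setoid

  Σ≡sum : ∀ {n} (f : Vector Carrier n) → Σ[ f ] ≡ sum f
  Σ≡sum {zero}  f = ≡.refl
  Σ≡sum {suc n} f = ≡.cong (f zero +_) (Σ≡sum (f ∘ suc))

  Π≡product : ∀ {n} (f : Vector Carrier n) → Π[ f ] ≡ product f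
  Π≡product {zero}  f = ≡.refl
  Π≡product {suc n} f = ≡.cong (f zero *_) (Π≡product (f ∘ suc))

  sumℕ≡sumᴺ : ∀ {n} (e : Fin n → ℕ) → sumℕ e ≡ sumᴺ e
  sumℕ≡sumᴺ {zero}  e = ≡.refl
  sumℕ≡sumᴺ {suc n} e = ≡.cong (e zero ℕ.+_) (sumℕ≡sumᴺ (e ∘ suc))

  sumℕ-↑ : ∀ {m n} (e : Fin (m ℕ.+ n) → ℕ) →
           sumℕ e ≡ sumℕ (e ∘ (_↑ˡ n)) ℕ.+ sumℕ (e ∘ (m ↑ʳ_))
  sumℕ-↑ {m} {n} e = ≡.trans (sumℕ≡sumᴺ e) (≡.trans (sum-↑ ℕₚ.+-0-monoid m e)
    (≡.sym (≡.cong₂ ℕ._+_ (sumℕ≡sumᴺ (e ∘ (_↑ˡ n))) (sumℕ≡sumᴺ (e ∘ (m ↑ʳ_))))))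

  sumℕ-++ : ∀ {m n} (e : Fin m → ℕ) (e' : Fin n → ℕ) → sumℕ (e ++ e') ≡ sumℕ e ℕ.+ sumℕ e'
  sumℕ-++ e e' = ≡.trans (sumℕ≡sumᴺ (e ++ e')) (≡.trans (sum-++ ℕₚ.+-0-monoid e e')
    (≡.sym (≡.cong₂ ℕ._+_ (sumℕ≡sumᴺ e) (sumℕ≡sumᴺ e'))))

  monomial-cong : ∀ {m} {e e' : Fin m → ℕ} → e ≡.≗ e' → ∀ x → monomial e x ≡ monomial e' x
  monomial-cong {e = e} {e'} e≗e' x = ≡.trans (Π≡product (λ j → pow (x j) (e j))) (≡.trans
    (product-cong-≗ (λ j → ≡.cong (pow (x j)) (e≗e' j))) (≡.sym (Π≡product (λ j → pow (x j) (e' j)))))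

  monomial-++ : ∀ {m m'} (e : Fin (m ℕ.+ m') → ℕ) (x : Point m) (y : Point m') →
    monomial e (x ++ y) ≈ monomial (e ∘ (_↑ˡ m')) x * monomial (e ∘ (m ↑ʳ_)) y
  monomial-++ {m} {m'} e x y = begin
    monomial e (x ++ y)
      ≡⟨ Π≡product (λ j → pow ((x ++ y) j) (e j)) ⟩
    product (λ j → pow ((x ++ y) j) (e j))
      ≈⟨ sum-↑ *-monoid m _ ⟩
    product (λ j → pow ((x ++ y) (j ↑ˡ m')) (e (j ↑ˡ m'))) * product (λ j → pow ((x ++ y) (m ↑ʳ j)) (e (m ↑ʳ j)))
      ≡⟨ ≡.cong₂ _*_ (product-cong-≗ (λ j → ≡.cong (λ z → pow z (e (j ↑ˡ m'))) (lookup-++ˡ x y j)))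
                     (product-cong-≗ (λ j → ≡.cong (λ z → pow z (e (m ↑ʳ j))) (lookup-++ʳ x y j))) ⟩
    product (λ j → pow (x j) (e (j ↑ˡ m'))) * product (λ j → pow (y j) (e (m ↑ʳ j)))
      ≡⟨ ≡.cong₂ _*_ (Π≡product (λ j → pow (x j) (e (j ↑ˡ m')))) (Π≡product (λ j → pow (y j) (e (m ↑ʳ j)))) ⟨
    monomial (e ∘ (_↑ˡ m')) x * monomial (e ∘ (m ↑ʳ_)) y
      ∎
    where open ≈-Reasoning

  monomial-++-++ : ∀ {m m'} (e : Fin m → ℕ) (e' : Fin m' → ℕ) (x : Point m) (y : Point m') →
    monomial (e ++ e') (x ++ y) ≈ monomial e x * monomial e' y
  monomial-++-++ e e' x y = trans (monomial-++ (e ++ e') x y)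
    (reflexive (≡.cong₂ _*_ (monomial-cong (lookup-++ˡ e e') x) (monomial-cong (lookup-++ʳ e e') y)))

  integral : ∀ {m} (X : FinSubset m) → Fun X → (Point m → Carrier) → Carrier
  integral X φ f = sum (λ i → φ i * f (pt X i))

  pairing≡integral : ∀ {m} (X : FinSubset m) (φ : Fun X) (p : Poly m) →
                     pairing X φ p ≡ integral X φ (eval p)
  pairing≡integral X φ p = Σ≡sum (λ i → φ i * eval p (pt X i))

  integral-cong : ∀ {m} (X : FinSubset m) {φ ψ : Fun X} (f g : Point m → Carrier) →
                  (∀ i → φ i ≈ ψ i) → (∀ x → f x ≈ g x) → integral X φ f ≈ integral X ψ g
  integral-cong X f g φ≈ψ f≈g = sum-cong-≋ (λ i → *-cong (φ≈ψ i) (f≈g (pt X i)))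

  integral-zeroˡ : ∀ {m} (X : FinSubset m) {φ : Fun X} (f : Point m → Carrier) →
                   (∀ i → φ i ≈ 0#) → integral X φ f ≈ 0#
  integral-zeroˡ X f φ≈0 =
    trans (sum-cong-≋ (λ i → trans (*-congʳ (φ≈0 i)) (zeroˡ _))) (sum-replicate-zero (size X))

  integral-zeroʳ : ∀ {m} (X : FinSubset m) (φ : Fun X) → integral X φ (λ _ → 0#) ≈ 0#
  integral-zeroʳ X φ = trans (sum-cong-≋ (λ i → zeroʳ (φ i))) (sum-replicate-zero (size X))

  integral-linear : ∀ {m} (X : FinSubset m) (φ : Fun X) a (f g : Point m → Carrier) →
    integral X φ (λ x → a * f x + g x) ≈ a * integral X φ f + integral X φ g
  integral-linear X φ a f g = begin
    integral X φ (λ x → a * f x + g x)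
      ≈⟨ sum-cong-≋ (λ i → trans (distribˡ (φ i) _ _) (+-congʳ (x∙yz≈y∙xz (φ i) a _))) ⟩
    sum (λ i → a * (φ i * f (pt X i)) + φ i * g (pt X i))
      ≈⟨ ∑-distrib-+ (λ i → a * (φ i * f (pt X i))) (λ i → φ i * g (pt X i)) ⟩
    sum (λ i → a * (φ i * f (pt X i))) + integral X φ g
      ≈⟨ +-congʳ (*-distribˡ-sum a (λ i → φ i * f (pt X i))) ⟨
    a * integral X φ f + integral X φ g
      ∎
    where open ≈-Reasoning

  integral-⊕ : ∀ {m} (X : FinSubset m) (φ ψ : Fun X) (f : Point m → Carrier) →
    integral X (_⊕_ {X = X} φ ψ) f ≈ integral X φ f + integral X ψ f
  integral-⊕ X φ ψ f = trans (sum-cong-≋ (λ i → distribʳ (f (pt X i)) (φ i) (ψ i)))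
    (∑-distrib-+ (λ i → φ i * f (pt X i)) (λ i → ψ i * f (pt X i)))

  integral-⊗ : ∀ {m m'} (X : FinSubset m) (Y : FinSubset m') (φ : Fun X) (ψ : Fun Y)
    {f : Point m → Carrier} {g : Point m' → Carrier} {h : Point (m ℕ.+ m') → Carrier} →
    (∀ x y → h (x ++ y) ≈ f x * g y) →
    integral (X ×ˢ Y) (_⊗_ {X = X} {Y = Y} φ ψ) h ≈ integral X φ f * integral Y ψ g
  integral-⊗ X Y φ ψ {f} {g} {h} h≈f*g = begin
    integral (X ×ˢ Y) (_⊗_ {X = X} {Y = Y} φ ψ) h
      ≈⟨ sum-combine +-monoid (size X) (size Y) _ ⟩
    ∑[ i < size X ] ∑[ j < size Y ] G (remQuot (size Y) (combine i j))
      ≡⟨ sum-cong-≗ (λ i → sum-cong-≗ (λ j → ≡.cong G (remQuot-combine i j))) ⟩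
    ∑[ i < size X ] ∑[ j < size Y ] G (i , j)
      ≈⟨ sum-cong-≋ (λ i → sum-cong-≋ (λ j →
           trans (*-congˡ (h≈f*g (pt X i) (pt Y j))) (interchange (φ i) (ψ j) _ _))) ⟩
    ∑[ i < size X ] ∑[ j < size Y ] ((φ i * f (pt X i)) * (ψ j * g (pt Y j)))
      ≈⟨ sum-cong-≋ (λ i → *-distribˡ-sum (φ i * f (pt X i)) (λ j → ψ j * g (pt Y j))) ⟨
    ∑[ i < size X ] ((φ i * f (pt X i)) * integral Y ψ g)
      ≈⟨ *-distribʳ-sum (integral Y ψ g) (λ i → φ i * f (pt X i)) ⟨
    integral X φ f * integral Y ψ g
      ∎
    where
    open ≈-Reasoning
    G : Fin (size X) × Fin (size Y) → Carrier
    G (i , j) = (φ i * ψ j) * h (pt X i ++ pt Y j)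

  infixr 7 _⊡_
  _⊡_ : ∀ {m m'} → Carrier × (Fin m → ℕ) → Poly m' → Poly (m ℕ.+ m')
  (a , e) ⊡ q = map (λ (b , e') → a * b , e ++ e') q

  infixl 7 _⊠_
  _⊠_ : ∀ {m m'} → Poly m → Poly m' → Poly (m ℕ.+ m')
  p ⊠ q = concatMap (_⊡ q) p

  eval-++ : ∀ {m} (p q : Poly m) x → eval (p ++ᴸ q) x ≈ eval p x + eval q x
  eval-++ []            q x = sym (+-identityˡ _)
  eval-++ ((a , e) ∷ p) q x = trans (+-congˡ (eval-++ p q x)) (sym (+-assoc _ _ _))

  eval-⊡ : ∀ {m m'} a (e : Fin m → ℕ) (q : Poly m') x y →
           eval ((a , e) ⊡ q) (x ++ y) ≈ (a * monomial e x) * eval q y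
  eval-⊡ a e []             x y = sym (zeroʳ _)
  eval-⊡ a e ((b , e') ∷ q) x y = begin
    (a * b) * monomial (e ++ e') (x ++ y) + eval ((a , e) ⊡ q) (x ++ y)
      ≈⟨ +-cong (*-congˡ (monomial-++-++ e e' x y)) (eval-⊡ a e q x y) ⟩
    (a * b) * (monomial e x * monomial e' y) + (a * monomial e x) * eval q y
      ≈⟨ +-congʳ (interchange a b _ _) ⟩
    (a * monomial e x) * (b * monomial e' y) + (a * monomial e x) * eval q y
      ≈⟨ distribˡ (a * monomial e x) _ _ ⟨
    (a * monomial e x) * (b * monomial e' y + eval q y)
      ∎
    where open ≈-Reasoning

  eval-⊠ : ∀ {m m'} (p : Poly m) (q : Poly m') x y → eval (p ⊠ q) (x ++ y) ≈ eval p x * eval q y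
  eval-⊠ []            q x y = sym (zeroˡ _)
  eval-⊠ ((a , e) ∷ p) q x y = begin
    eval ((a , e) ⊡ q ++ᴸ p ⊠ q) (x ++ y)
      ≈⟨ eval-++ ((a , e) ⊡ q) (p ⊠ q) (x ++ y) ⟩
    eval ((a , e) ⊡ q) (x ++ y) + eval (p ⊠ q) (x ++ y)
      ≈⟨ +-cong (eval-⊡ a e q x y) (eval-⊠ p q x y) ⟩
    (a * monomial e x) * eval q y + eval p x * eval q y
      ≈⟨ distribʳ (eval q y) _ _ ⟨
    (a * monomial e x + eval p x) * eval q y
      ∎
    where open ≈-Reasoning

  deg-++ : ∀ {m} (p q : Poly m) → deg (p ++ᴸ q) ≡ deg p ℕ.⊔ deg q
  deg-++ []            q = ≡.refl
  deg-++ ((a , e) ∷ p) q = ≡.trans (≡.cong (sumℕ e ℕ.⊔_) (deg-++ p q)) (≡.sym (ℕₚ.⊔-assoc (sumℕ e) _ _))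

  deg-⊡ : ∀ {m m'} a (e : Fin m → ℕ) (q : Poly m') → deg ((a , e) ⊡ q) ≤ sumℕ e ℕ.+ deg q
  deg-⊡ a e []             = ℕ.z≤n
  deg-⊡ a e ((b , e') ∷ q) = begin
    sumℕ (e ++ e') ℕ.⊔ deg ((a , e) ⊡ q)
      ≤⟨ ℕₚ.⊔-mono-≤ (ℕₚ.≤-reflexive (sumℕ-++ e e')) (deg-⊡ a e q) ⟩
    (sumℕ e ℕ.+ sumℕ e') ℕ.⊔ (sumℕ e ℕ.+ deg q)
      ≡⟨ ℕₚ.+-distribˡ-⊔ (sumℕ e) (sumℕ e') (deg q) ⟨
    sumℕ e ℕ.+ (sumℕ e' ℕ.⊔ deg q)
      ∎
    where open ℕₚ.≤-Reasoning

  deg-⊠ : ∀ {m m'} (p : Poly m) (q : Poly m') → deg (p ⊠ q) ≤ deg p ℕ.+ deg q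
  deg-⊠ []            q = ℕ.z≤n
  deg-⊠ ((a , e) ∷ p) q = begin
    deg ((a , e) ⊡ q ++ᴸ p ⊠ q)
      ≡⟨ deg-++ ((a , e) ⊡ q) (p ⊠ q) ⟩
    deg ((a , e) ⊡ q) ℕ.⊔ deg (p ⊠ q)
      ≤⟨ ℕₚ.⊔-mono-≤ (deg-⊡ a e q) (deg-⊠ p q) ⟩
    (sumℕ e ℕ.+ deg q) ℕ.⊔ (deg p ℕ.+ deg q)
      ≡⟨ ℕₚ.+-distribʳ-⊔ (deg q) (sumℕ e) (deg p) ⟨
    (sumℕ e ℕ.⊔ deg p) ℕ.+ deg q
      ∎
    where open ℕₚ.≤-Reasoning

  MomentsVanishBelow : ∀ {m} (X : FinSubset m) → Fun X → ℕ∞ → Set ℓ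
  MomentsVanishBelow X φ a = ∀ e → sumℕ e <∞ a → integral X φ (monomial e) ≈ 0#

  moments⇒pairings : ∀ {m} (X : FinSubset m) {φ : Fun X} a → MomentsVanishBelow X φ a →
                     ∀ p → deg p <∞ a → pairing X φ p ≈ 0#
  moments⇒pairings X {φ} a vanish p deg<a =
    trans (reflexive (pairing≡integral X φ p)) (integral-eval p deg<a)
    where
    integral-eval : ∀ p → deg p <∞ a → integral X φ (eval p) ≈ 0#
    integral-eval []            _     = integral-zeroʳ X φ
    integral-eval ((b , e) ∷ p) deg<a = begin
      integral X φ (λ x → b * monomial e x + eval p x)
        ≈⟨ integral-linear X φ b (monomial e) (eval p) ⟩
      b * integral X φ (monomial e) + integral X φ (eval p)
        ≈⟨ +-cong (*-congˡ (vanish e (≤-<∞-trans a (ℕₚ.m≤m⊔n _ _) deg<a)))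
                  (integral-eval p (≤-<∞-trans a (ℕₚ.m≤n⊔m _ _) deg<a)) ⟩
      b * 0# + 0#
        ≈⟨ trans (+-identityʳ _) (zeroʳ b) ⟩
      0#
        ∎
      where open ≈-Reasoning

  orth⇒pairings : ∀ {m} (X : FinSubset m) {φ : Fun X} a → Orth X φ a →
                  ∀ p → deg p <∞ a → pairing X φ p ≈ 0#
  orth⇒pairings X (fin d) (_ , vanish) = vanish
  orth⇒pairings X ∞       vanish p _   = vanish p

  orth⇒moments : ∀ {m} (X : FinSubset m) {φ : Fun X} a → Orth X φ a → MomentsVanishBelow X φ a
  orth⇒moments X {φ} a orth e e<a = begin
    integral X φ (monomial e)
      ≈⟨ integral-cong X (monomial e) (eval ((1# , e) ∷ [])) (λ _ → refl) (λ x → sym (trans (+-identityʳ _) (*-identityˡ _))) ⟩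
    integral X φ (eval ((1# , e) ∷ []))
      ≡⟨ pairing≡integral X φ ((1# , e) ∷ []) ⟨
    pairing X φ ((1# , e) ∷ [])
      ≈⟨ orth⇒pairings X a orth ((1# , e) ∷ []) (≡.subst (_<∞ a) (≡.sym (ℕₚ.⊔-identityʳ (sumℕ e))) e<a) ⟩
    0#
      ∎
    where open ≈-Reasoning

  orth-≥ : ∀ {m} (X : FinSubset m) {φ : Fun X} a s → MomentsVanishBelow X φ a → Orth X φ s → a ≤∞ s
  orth-≥ X a ∞       _      _                        = a ≤∞∞
  orth-≥ X a (fin _) vanish ((p , ≡.refl , φp≉0) , _) =
    ≮∞⇒≥∞ a (λ deg<a → φp≉0 (moments⇒pairings X a vanish p deg<a))

  orth-≤ : ∀ {m} (X : FinSubset m) {φ : Fun X} s {d} (p : Poly m) →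
           Orth X φ s → deg p ≤ d → ¬ (pairing X φ p ≈ 0#) → s ≤∞ fin d
  orth-≤ X s p orth deg≤d φp≉0 =
    ≮∞⇒≥∞ s (λ d<s → φp≉0 (orth⇒pairings X s orth p (≤-<∞-trans s deg≤d d<s)))

  moments-cong : ∀ {m} (X : FinSubset m) {φ ψ : Fun X} a →
                 (∀ i → φ i ≈ ψ i) → MomentsVanishBelow X φ a → MomentsVanishBelow X ψ a
  moments-cong X a φ≈ψ vanish e e<a =
    trans (integral-cong X (monomial e) (monomial e) (λ i → sym (φ≈ψ i)) (λ _ → refl)) (vanish e e<a)

  moments-zero : ∀ {m} (X : FinSubset m) {φ : Fun X} a → (∀ i → φ i ≈ 0#) → MomentsVanishBelow X φ a
  moments-zero X a φ≈0 e _ = integral-zeroˡ X (monomial e) φ≈0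

  moments-⊕ : ∀ {m} (X : FinSubset m) {φ ψ : Fun X} a b →
              MomentsVanishBelow X φ a → MomentsVanishBelow X ψ b →
              MomentsVanishBelow X (_⊕_ {X = X} φ ψ) (min∞ a b)
  moments-⊕ X {φ} {ψ} a b vanishφ vanishψ e e<a⊓b = begin
    integral X (_⊕_ {X = X} φ ψ) (monomial e)
      ≈⟨ integral-⊕ X φ ψ (monomial e) ⟩
    integral X φ (monomial e) + integral X ψ (monomial e)
      ≈⟨ +-cong (vanishφ e (proj₁ (<∞-min⁻ a b e<a⊓b))) (vanishψ e (proj₂ (<∞-min⁻ a b e<a⊓b))) ⟩
    0# + 0#
      ≈⟨ +-identityˡ 0# ⟩
    0#
      ∎
    where open ≈-Reasoning

  module _ {m m'} (X : FinSubset m) (Y : FinSubset m') {φ : Fun X} {ψ : Fun Y} where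

    moment-⊗ : ∀ e → integral (X ×ˢ Y) (_⊗_ {X = X} {Y = Y} φ ψ) (monomial e)
                   ≈ integral X φ (monomial (e ∘ (_↑ˡ m'))) * integral Y ψ (monomial (e ∘ (m ↑ʳ_)))
    moment-⊗ e = integral-⊗ X Y φ ψ {h = monomial e} (monomial-++ e)

    moments-⊗ˡ : ∀ a → MomentsVanishBelow X φ a → MomentsVanishBelow (X ×ˢ Y) (_⊗_ {X = X} {Y = Y} φ ψ) a
    moments-⊗ˡ a vanish e e<a = trans (moment-⊗ e) (trans (*-congʳ (vanish (e ∘ (_↑ˡ m')) e₁<a)) (zeroˡ _))
      where
      e₁<a = ≤-<∞-trans a (ℕₚ.≤-trans (ℕₚ.m≤m+n _ _) (ℕₚ.≤-reflexive (≡.sym (sumℕ-↑ {m} {m'} e)))) e<a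

    moments-⊗ʳ : ∀ a → MomentsVanishBelow Y ψ a → MomentsVanishBelow (X ×ˢ Y) (_⊗_ {X = X} {Y = Y} φ ψ) a
    moments-⊗ʳ a vanish e e<a = trans (moment-⊗ e) (trans (*-congˡ (vanish (e ∘ (m ↑ʳ_)) e₂<a)) (zeroʳ _))
      where
      e₂<a = ≤-<∞-trans a (ℕₚ.≤-trans (ℕₚ.m≤n+m _ _) (ℕₚ.≤-reflexive (≡.sym (sumℕ-↑ {m} {m'} e)))) e<a

    moments-⊗ : ∀ a b → MomentsVanishBelow X φ a → MomentsVanishBelow Y ψ b →
                MomentsVanishBelow (X ×ˢ Y) (_⊗_ {X = X} {Y = Y} φ ψ) (a +∞ b)
    moments-⊗ a b vanishφ vanishψ e e<a+b with +-<∞-+⁻ a b (≡.subst (_<∞ a +∞ b) (sumℕ-↑ {m} {m'} e) e<a+b)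
    ... | inj₁ e₁<a = trans (moment-⊗ e) (trans (*-congʳ (vanishφ (e ∘ (_↑ˡ m')) e₁<a)) (zeroˡ _))
    ... | inj₂ e₂<b = trans (moment-⊗ e) (trans (*-congˡ (vanishψ (e ∘ (m ↑ʳ_)) e₂<b)) (zeroʳ _))

    pairing-⊠ : ∀ p q → pairing (X ×ˢ Y) (_⊗_ {X = X} {Y = Y} φ ψ) (p ⊠ q) ≈ pairing X φ p * pairing Y ψ q
    pairing-⊠ p q = begin
      pairing (X ×ˢ Y) (_⊗_ {X = X} {Y = Y} φ ψ) (p ⊠ q)
        ≡⟨ pairing≡integral (X ×ˢ Y) (_⊗_ {X = X} {Y = Y} φ ψ) (p ⊠ q) ⟩
      integral (X ×ˢ Y) (_⊗_ {X = X} {Y = Y} φ ψ) (eval (p ⊠ q))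
        ≈⟨ integral-⊗ X Y φ ψ {h = eval (p ⊠ q)} (eval-⊠ p q) ⟩
      integral X φ (eval p) * integral Y ψ (eval q)
        ≡⟨ ≡.cong₂ _*_ (pairing≡integral X φ p) (pairing≡integral Y ψ q) ⟨
      pairing X φ p * pairing Y ψ q
        ∎
      where open ≈-Reasoning

  x-y+y-z≈x-z : ∀ x y z → (x - y) + (y - z) ≈ x - z
  x-y+y-z≈x-z x y z = begin
    (x - y) + (y - z)      ≈⟨ +-assoc x (- y) (y - z) ⟩
    x + (- y + (y - z))    ≈⟨ +-congˡ (+-assoc (- y) y (- z)) ⟨
    x + ((- y + y) - z)    ≈⟨ +-congˡ (+-congʳ (-‿inverseˡ y)) ⟩
    x + (0# - z)           ≈⟨ +-congˡ (+-identityˡ (- z)) ⟩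
    x - z                  ∎
    where open ≈-Reasoning

  xu-yv≈[x-y]u+y[u-v] : ∀ x y u v → x * u - y * v ≈ (x - y) * u + y * (u - v)
  xu-yv≈[x-y]u+y[u-v] x y u v = sym (begin
    (x - y) * u + y * (u - v)        ≈⟨ +-cong ([y-z]x≈yx-zx u x y) (x[y-z]≈xy-xz y u v) ⟩
    (x * u - y * u) + (y * u - y * v) ≈⟨ x-y+y-z≈x-z (x * u) (y * u) (y * v) ⟩
    x * u - y * v                    ∎)
    where open ≈-Reasoning

  moments-⊖-^⊗ : ∀ {m} (X : FinSubset m) {φ ψ : Fun X} a →
    MomentsVanishBelow X (_⊖_ {X = X} φ ψ) a →
    ∀ n → MomentsVanishBelow (X ^ˢ n) (_⊖_ {X = X ^ˢ n} (_^⊗_ {X = X} φ n) (_^⊗_ {X = X} ψ n)) a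
  moments-⊖-^⊗ X a vanish zero    = moments-zero (X ^ˢ zero) a (λ _ → -‿inverseʳ 1#)
  moments-⊖-^⊗ X {φ} {ψ} a vanish (suc n) =
    moments-cong (X ^ˢ suc n) a (λ _ → sym (xu-yv≈[x-y]u+y[u-v] _ _ _ _))
      (≡.subst (MomentsVanishBelow (X ^ˢ suc n) _) (min∞-idem a)
        (moments-⊕ (X ^ˢ suc n) a a
          (moments-⊗ˡ (X ^ˢ n) X {ψ = φ} a (moments-⊖-^⊗ X a vanish n))
          (moments-⊗ʳ (X ^ˢ n) X {φ = _^⊗_ {X = X} ψ n} a vanish)))

  module _ (isField : IsField F) where
    open IsField isField

    *-≉0 : ∀ {x y} → ¬ (x ≈ 0#) → ¬ (y ≈ 0#) → ¬ (x * y ≈ 0#)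
    *-≉0 {x} {y} x≉0 y≉0 xy≈0 with inverse x x≉0
    ... | x⁻¹ , xx⁻¹≈1 = y≉0 (begin
      y              ≈⟨ *-identityˡ y ⟨
      1# * y         ≈⟨ *-congʳ xx⁻¹≈1 ⟨
      (x * x⁻¹) * y  ≈⟨ xy∙z≈y∙xz x x⁻¹ y ⟩
      x⁻¹ * (x * y)  ≈⟨ *-congˡ xy≈0 ⟩
      x⁻¹ * 0#       ≈⟨ zeroʳ x⁻¹ ⟩
      0#             ∎)
      where open ≈-Reasoning

    orth-⊗-≤ : ∀ {m m'} (X : FinSubset m) (Y : FinSubset m') {φ : Fun X} {ψ : Fun Y} a b t →
               Orth X φ a → Orth Y ψ b → Orth (X ×ˢ Y) (_⊗_ {X = X} {Y = Y} φ ψ) t → t ≤∞ a +∞ b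
    orth-⊗-≤ X Y (fin _) (fin _) t ((p , ≡.refl , φp≉0) , _) ((q , ≡.refl , ψq≉0) , _) orth =
      orth-≤ (X ×ˢ Y) t (p ⊠ q) orth (deg-⊠ p q)
        (λ φ⊗ψ[p⊠q]≈0 → *-≉0 φp≉0 ψq≉0 (trans (sym (pairing-⊠ X Y p q)) φ⊗ψ[p⊠q]≈0))
    orth-⊗-≤ X Y (fin _) ∞ t _ _ _ = t ≤∞∞
    orth-⊗-≤ X Y ∞       b t _ _ _ = t ≤∞∞

proposition2p1 : ∀ {c ℓ : Level} (F : CommutativeRing c ℓ) → IsField F →
    let open Over F in
    ∀ {m m' : ℕ} (X : FinSubset m) (Y : FinSubset m') →
    Distinct X → Distinct Y → Nonempty X → Nonempty Y →
    -- (i)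
    (∀ (φ ψ : Fun X) (a b s : ℕ∞) →
       Orth X φ a → Orth X ψ b → Orth X (_⊕_ {X = X} φ ψ) s → min∞ a b ≤∞ s)
    -- (ii)
    × (∀ (φ : Fun X) (ψ : Fun Y) (a b t : ℕ∞) →
       Orth X φ a → Orth Y ψ b → Orth (X ×ˢ Y) (_⊗_ {X = X} {Y = Y} φ ψ) t → t ≡ a +∞ b)
    -- (iii)
    × (∀ (φ ψ : Fun X) (n : ℕ) → 1 ≤ n → (a s : ℕ∞) →
       Orth X (_⊖_ {X = X} φ ψ) a → Orth (X ^ˢ n) (_⊖_ {X = X ^ˢ n} (_^⊗_ {X = X} φ n) (_^⊗_ {X = X} ψ n)) s → a ≤∞ s)
proposition2p1 F isField X Y _ _ _ _ =
    (λ φ ψ a b s orthφ orthψ orthφ⊕ψ →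
       orth-≥ X (min∞ a b) s
         (moments-⊕ X a b (orth⇒moments X a orthφ) (orth⇒moments X b orthψ)) orthφ⊕ψ)
  , (λ φ ψ a b t orthφ orthψ orthφ⊗ψ → ≤∞-antisym
       (orth-⊗-≤ isField X Y a b t orthφ orthψ orthφ⊗ψ)
       (orth-≥ (X ×ˢ Y) (a +∞ b) t
         (moments-⊗ X Y a b (orth⇒moments X a orthφ) (orth⇒moments Y b orthψ)) orthφ⊗ψ))
  , (λ φ ψ n _ a s orthφ⊖ψ orthφⁿ⊖ψⁿ →
       orth-≥ (X ^ˢ n) a s (moments-⊖-^⊗ X a (orth⇒moments X a orthφ⊖ψ) n) orthφⁿ⊖ψⁿ)
  where
  open Over F
  open OrthogonalContent F
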